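{- For a given ordering $x$ of the $n_d$ destinations and a given $p\in\mathbb N$, the meta graph for the neighbourhood $\mathcal N_{BS-R}(x,p)$ (whose states are the $\mathcal N_{BS-R}$-valid metastates) has $O(n_dn_r2^p)$ states, where $n_r$ is the number of replenishment locations.
   Context: Let $V_d=\{v_1,\dots,v_{n_d}\}$ be the destinations, $V_r$ ($|V_r|=n_r$) the replenishment locations, $x=(v_1,\dots,v_{n_d})$, $p\in\mathbb N$. For a permutation $\sigma$ of $[n_d]$ ($\sigma(i)$ = new position of $v_i$), $(v_{\sigma^{ -1}(1)},\dots,v_{\sigma^{ -1}(n_d)})\in\mathcal N_{BS}(x,p)$ iff $\sigma(i)<\sigma(j)$ for all $i,j$ with $i+p\le j$. A metastate at stage $k\in\{0,\dots,n_d\}$ is a pair $(S,w)$ with $S\subseteq V_d$, $|S|=k$, $w\in V_r$; it is $\mathcal N_{BS-R}$-valid iff there is a sequence in $\mathcal N_{BS}(x,p)$ whose first $k$ entries form exactly the set $S$. -}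

module Defs where

open import Data.Nat using (ℕ; _+_; _≤_; _<_)
open import Data.Fin using (Fin; toℕ)
import Data.Fin as Fin
open import Data.Fin.Subset using (Subset; _∈_; ∣_∣)
open import Data.Fin.Permutation using (Permutation′; _⟨$⟩ʳ_)
open import Data.Product using (Σ; _×_; _,_; ∃-syntax)
open import Relation.Binary.PropositionalEquality using (_≡_)
open import Function.Bundles using (_⇔_)

-- Destinations v_1..v_{nd} are represented by Fin nd (v_{i+1} ↔ i),
-- the fixed ordering x is the identity order on Fin nd.
-- A permutation σ maps each destination to its new position (0-indexed).
InBS : (nd p : ℕ) → Permutation′ nd → Set
InBS nd p σ = ∀ (i j : Fin nd) → toℕ i + p ≤ toℕ j → (σ ⟨$⟩ʳ i) Fin.< (σ ⟨$⟩ʳ j)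

-- A metastate at stage k: a set S ⊆ V_d with |S| = k and a replenishment
-- location w ∈ V_r (V_r represented by Fin nr).
-- It is N_BS-R-valid iff some sequence in N_BS(x,p) has its first k entries
-- forming exactly S (first k positions = positions 0..k-1).
ValidMetastate : (nd nr p : ℕ) → ℕ × Subset nd × Fin nr → Set
ValidMetastate nd nr p (k , S , w) =
  k ≤ nd × ∣ S ∣ ≡ k ×
  (∃[ σ ] (InBS nd p σ × (∀ (i : Fin nd) → (i ∈ S) ⇔ (toℕ (σ ⟨$⟩ʳ i) < k))))

-- A valid metastate (k , S , w) is determined by S and w, and S is "p-down-closed": a position
-- j ∈ S forces every i with i + p ≤ j into S, since σ moves i strictly before j and S is the set
-- of the first k positions. Such an S is an initial run [0, m) with m ∉ S, and it contains nothing
-- from m + p on; so S is determined by m ≤ n_d and the p membership bits starting at m. Hence an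
-- injective encoding into (Fin (n_d + 1) × Subset p) × V_r, of size (n_d + 1) 2^p n_r ≤ 2 n_d n_r 2^p.
module Submission where

open import Defs
open import Data.Nat using (ℕ; zero; suc; _*_; _^_; _+_; _≤_; z≤n; s≤s)
open import Data.Nat.Properties
  using (<-trans; +-identityʳ; +-monoˡ-≤; *-monoˡ-≤; *-commutativeSemigroup; module ≤-Reasoning)
open import Algebra.Properties.CommutativeSemigroup *-commutativeSemigroup using (xy∙z≈xz∙y)
open import Data.Fin using (Fin; toℕ; suc; zero)
open import Data.Fin.Subset using (Subset; inside; outside; _∈_; _∉_)
open import Data.Fin.Subset.Properties using (drop-there)
open import Data.Vec using ([]; _∷_; here; there)
open import Data.Product using (_×_; _,_; proj₁; proj₂; map₁; ∃-syntax)
open import Data.List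
  using (List; []; _∷_; length; map; upTo; allFin; cartesianProductWith; cartesianProduct)
open import Data.List.Properties
  using (length-++; length-map; length-upTo; length-tabulate; length-removeAt′)
open import Data.List.Relation.Unary.All using (All; []; _∷_; zipWith)
import Data.List.Relation.Unary.All as All
open import Data.List.Relation.Unary.All.Properties using (map⁺)
open import Data.List.Relation.Unary.Any using (here; there; _─_)
open import Data.List.Relation.Unary.AllPairs using ([]; _∷_)
open import Data.List.Relation.Unary.Unique.Propositional using (Unique)
open import Data.List.Membership.Propositional using () renaming (_∈_ to _∈ₗ_)
open import Data.List.Membership.Propositional.Properties
  using (∈-map⁻; ∈-upTo⁺; ∈-allFin; ∈-cartesianProductWith⁺; ∈-cartesianProduct⁺)
open import Data.List.Relation.Binary.Subset.Propositional using (_⊆_)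
open import Data.Empty using (⊥-elim)
open import Function using (_∘_)
open import Function.Bundles using (Equivalence)
open import Relation.Binary.PropositionalEquality using (_≡_; _≢_; refl; sym; trans; cong; cong₂)

module _ {A : Set} where

  ∈-─⁺ : ∀ {x y : A} {ys} (x∈ys : x ∈ₗ ys) → x ≢ y → y ∈ₗ ys → y ∈ₗ (ys ─ x∈ys)
  ∈-─⁺ (here refl) x≢y (here refl) = ⊥-elim (x≢y refl)
  ∈-─⁺ (here _)    _   (there y∈ys) = y∈ys
  ∈-─⁺ (there _)   _   (here refl) = here refl
  ∈-─⁺ (there x∈ys) x≢y (there y∈ys) = there (∈-─⁺ x∈ys x≢y y∈ys)

  Unique-⊆⇒length≤ : ∀ {xs ys : List A} → Unique xs → xs ⊆ ys → length xs ≤ length ys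
  Unique-⊆⇒length≤ {[]} _ _ = z≤n
  Unique-⊆⇒length≤ {x ∷ xs} {ys} (x≢xs ∷ unique) xs⊆ys = begin
    suc (length xs)             ≤⟨ s≤s (Unique-⊆⇒length≤ unique xs⊆ys─x) ⟩
    suc (length (ys ─ x∈ys))    ≡⟨ sym (length-removeAt′ ys _) ⟩
    length ys                   ∎
    where
      open ≤-Reasoning
      x∈ys = xs⊆ys (here refl)
      xs⊆ys─x : xs ⊆ (ys ─ x∈ys)
      xs⊆ys─x y∈xs = ∈-─⁺ x∈ys (All.lookup x≢xs y∈xs) (xs⊆ys (there y∈xs))

module _ {A B : Set} {P : A → Set} (f : A → B)
         (f-injectiveOn : ∀ {x y} → P x → P y → f x ≡ f y → x ≡ y) where

  map⁺-injectiveOn : ∀ {xs} → All P xs → Unique xs → Unique (map f xs)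
  map⁺-injectiveOn [] [] = []
  map⁺-injectiveOn (px ∷ pxs) (x≢xs ∷ unique) =
    map⁺ (zipWith (λ (py , x≢y) → x≢y ∘ f-injectiveOn px py) (pxs , x≢xs))
      ∷ map⁺-injectiveOn pxs unique

length-cartesianProductWith : ∀ {A B C : Set} (f : A → B → C) xs ys →
  length (cartesianProductWith f xs ys) ≡ length xs * length ys
length-cartesianProductWith f [] ys = refl
length-cartesianProductWith f (x ∷ xs) ys =
  trans (length-++ (map (f x) ys))
        (cong₂ _+_ (length-map (f x) ys) (length-cartesianProductWith f xs ys))

allSubsets : ∀ p → List (Subset p)
allSubsets zero = [] ∷ []
allSubsets (suc p) = cartesianProductWith _∷_ (inside ∷ outside ∷ []) (allSubsets p)

length-allSubsets : ∀ p → length (allSubsets p) ≡ 2 ^ p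
length-allSubsets zero = refl
length-allSubsets (suc p) =
  trans (length-cartesianProductWith _∷_ (inside ∷ outside ∷ []) (allSubsets p))
        (cong (2 *_) (length-allSubsets p))

∈-allSubsets : ∀ {p} (S : Subset p) → S ∈ₗ allSubsets p
∈-allSubsets [] = here refl
∈-allSubsets (inside ∷ S) =
  ∈-cartesianProductWith⁺ _∷_ {xs = inside ∷ outside ∷ []} (here refl) (∈-allSubsets S)
∈-allSubsets (outside ∷ S) =
  ∈-cartesianProductWith⁺ _∷_ {xs = inside ∷ outside ∷ []} (there (here refl)) (∈-allSubsets S)

resize : ∀ {m n} → Subset m → Subset n
resize {n = zero} _ = []
resize {n = suc n} [] = outside ∷ resize []
resize {n = suc n} (s ∷ S) = s ∷ resize S

resize-resize : ∀ {n} p (S : Subset n) → (∀ j → p ≤ toℕ j → j ∉ S) → resize (resize {n = p} S) ≡ S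
resize-resize p [] _ = refl
resize-resize zero (inside ∷ S) S<p = ⊥-elim (S<p zero z≤n here)
resize-resize zero (outside ∷ S) S<p =
  cong (outside ∷_) (resize-resize zero S (λ j _ → S<p (suc j) z≤n ∘ there))
resize-resize (suc p) (s ∷ S) S<p =
  cong (s ∷_) (resize-resize p S (λ j p≤j → S<p (suc j) (s≤s p≤j) ∘ there))

DownClosed : ∀ {n} → ℕ → Subset n → Set
DownClosed p S = ∀ i j → toℕ i + p ≤ toℕ j → j ∈ S → i ∈ S

DownClosed-tail : ∀ {n p s} {S : Subset n} → DownClosed p (s ∷ S) → DownClosed p S
DownClosed-tail closed i j i+p≤j j∈S = drop-there (closed (suc i) (suc j) (s≤s i+p≤j) (there j∈S))

code : ∀ {n} p → Subset n → ℕ × Subset p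
code p (inside ∷ S) = map₁ suc (code p S)
code p S = 0 , resize S

decode : ∀ {n p} → ℕ × Subset p → Subset n
decode {n = suc n} (suc m , W) = inside ∷ decode (m , W)
decode (_ , W) = resize W

decode-code : ∀ {n} p (S : Subset n) → DownClosed p S → decode (code p S) ≡ S
decode-code p [] _ = refl
decode-code p (inside ∷ S) closed = cong (inside ∷_) (decode-code p S (DownClosed-tail closed))
decode-code p (outside ∷ S) closed =
  resize-resize p (outside ∷ S) (λ j p≤j j∈S → zero∉ (closed zero j p≤j j∈S))
  where
    zero∉ : zero ∉ outside ∷ S
    zero∉ ()

code-injective : ∀ {n} p (S T : Subset n) → DownClosed p S → DownClosed p T →
  code p S ≡ code p T → S ≡ T
code-injective p S T S-closed T-closed S≡T = trans (sym (decode-code p S S-closed))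
  (trans (cong decode S≡T) (decode-code p T T-closed))

code-run≤ : ∀ {n} p (S : Subset n) → proj₁ (code p S) ≤ n
code-run≤ p [] = z≤n
code-run≤ p (inside ∷ S) = s≤s (code-run≤ p S)
code-run≤ p (outside ∷ S) = z≤n

module _ {nd nr p : ℕ} where

  valid⇒DownClosed : ∀ {k S w} → ValidMetastate nd nr p (k , S , w) → DownClosed p S
  valid⇒DownClosed (_ , _ , _ , σ∈BS , S≡prefix) i j i+p≤j j∈S =
    Equivalence.from (S≡prefix i) (<-trans (σ∈BS i j i+p≤j) (Equivalence.to (S≡prefix j) j∈S))

  encode : ℕ × Subset nd × Fin nr → (ℕ × Subset p) × Fin nr
  encode (_ , S , w) = code p S , w

  encode-injectiveOn : ∀ {a b} → ValidMetastate nd nr p a → ValidMetastate nd nr p b →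
    encode a ≡ encode b → a ≡ b
  encode-injectiveOn {k , S , w} {l , T , v} va@(_ , ∣S∣≡k , _) vb@(_ , ∣T∣≡l , _) eq
    with refl ← code-injective p S T (valid⇒DownClosed {k} {S} {w} va)
                                     (valid⇒DownClosed {l} {T} {v} vb) (cong proj₁ eq)
       | refl ← cong proj₂ eq
    = cong (_, S , w) (trans (sym ∣S∣≡k) ∣T∣≡l)

  codes : List ((ℕ × Subset p) × Fin nr)
  codes = cartesianProduct (cartesianProduct (upTo (suc nd)) (allSubsets p)) (allFin nr)

  encode-∈-codes : ∀ a → encode a ∈ₗ codes
  encode-∈-codes (_ , S , w) = ∈-cartesianProduct⁺
    (∈-cartesianProduct⁺ (∈-upTo⁺ (s≤s (code-run≤ p S))) (∈-allSubsets _)) (∈-allFin w)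

  length-codes : length codes ≡ suc nd * 2 ^ p * nr
  length-codes =
    trans (length-cartesianProductWith _,_ (cartesianProduct (upTo (suc nd)) (allSubsets p)) (allFin nr))
    (cong₂ _*_ (trans (length-cartesianProductWith _,_ (upTo (suc nd)) (allSubsets p))
                      (cong₂ _*_ (length-upTo (suc nd)) (length-allSubsets p)))
               (length-tabulate {n = nr} (λ i → i)))

  Unique-valid⇒length≤ : ∀ {xs} → Unique xs → All (ValidMetastate nd nr p) xs →
    length xs ≤ suc nd * 2 ^ p * nr
  Unique-valid⇒length≤ {xs} unique valid = begin
    length xs                ≡⟨ length-map encode xs ⟨
    length (map encode xs)   ≤⟨ Unique-⊆⇒length≤ (map⁺-injectiveOn encode encode-injectiveOn valid unique)
                                                 encodings-⊆-codes ⟩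
    length codes             ≡⟨ length-codes ⟩
    suc nd * 2 ^ p * nr      ∎
    where
      open ≤-Reasoning
      encodings-⊆-codes : map encode xs ⊆ codes
      encodings-⊆-codes y∈ with a , _ , refl ← ∈-map⁻ encode y∈ = encode-∈-codes a

proposition8 : ∃[ C ] (∀ (nd nr p : ℕ) → 1 ≤ nd →
    (xs : List (ℕ × Subset nd × Fin nr)) →
    Unique xs → All (ValidMetastate nd nr p) xs →
    length xs ≤ C * nd * nr * 2 ^ p)
proposition8 = 2 , λ nd nr p 1≤nd xs unique valid → begin
  length xs                ≤⟨ Unique-valid⇒length≤ unique valid ⟩
  suc nd * 2 ^ p * nr      ≤⟨ *-monoˡ-≤ nr (*-monoˡ-≤ (2 ^ p) (+-monoˡ-≤ nd 1≤nd)) ⟩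
  (nd + nd) * 2 ^ p * nr   ≡⟨ cong (λ m → (nd + m) * 2 ^ p * nr) (+-identityʳ nd) ⟨
  2 * nd * 2 ^ p * nr      ≡⟨ xy∙z≈xz∙y (2 * nd) (2 ^ p) nr ⟩
  2 * nd * nr * 2 ^ p      ∎
  where open ≤-Reasoning
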